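{- If a function $f\colon[0,1]\to\mathbb{R}$ has a continuous modulus, then $f$ is induced by a code of a continuous function.
   Context: The setting is constructive. Reals and moduli: - Real numbers are regular sequences of rationals $\langle r_n\rangle$ with $|r_n-r_{n+1}|\le2^{ -(n+1)}$, with equality $\langle r_n\rangle\simeq\langle q_n\rangle$ iff $\forall n\,|r_{n+1}-q_{n+1}|\le2^{ -n}$. Functions $[0,1]\to\mathbb{R}$ respect $\simeq$. - Fix a bijective coding of $\mathbb{Q}$ by $\mathbb{N}$. Let $|[0,1]|$ be the set of regular sequences in $[0,1]$, viewed as a subset of $\mathbb{N}^{\mathbb{N}}$ with pointwise equality. - A modulus of $f$ is $g\colon\mathbb{N}\to|[0,1]|\to\mathbb{N}$ with $\forall k\,\forall x,y\in[0,1]\,(|x-y|\le2^{ -g_k(x)}\to|f(x)-f(y)|\le2^{ -k})$. It is continuous if each $g_k$ is pointwise continuous with respect to initial segments. Ternary tree: - For $s\in\{0,1,2\}^*$, define $N(\langle\rangle)=1$ and $N(s*\langle i\rangle)=2N(s)+(i-1)$. - For $\alpha\in\{0,1,2\}^{\mathbb{N}}$, $\Phi(\alpha)=\langle2^{ -(n+1)}N(\overline{\alpha}n)\rangle_n$. - For $s\in\{0,1,2\}^*$, $\mathbb{I}_s=(2^{ -(|s|+1)}(N(s)-1),\,2^{ -(|s|+1)}(N(s)+1))$. Rational intervals: - $\mathbb{T}=\{(p,q)\in\mathbb{Q}^2:p\le q\}$, identified with a subset of $\mathbb{N}$ via a fixed coding. - For $I=(p,q)$: $|I|=q-p$. - $(p,q)\sqsubseteq(p',q')$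 iff $p'\le p$ and $q\le q'$. - $(p,q)\approx(p',q')$ iff $p'\le q$ and $p\le q'$. - $\dot-$ is truncated subtraction. Codes: - A code of a continuous function is $\varphi\colon\{0,1,2\}^*\to\mathbb{N}$ such that: (C1) $\varphi(s)\ne0\to\varphi(s)\dot-1\in\mathbb{T}$; (C2) $\forall k\,\forall\alpha\,\exists n\,(\varphi(\overline{\alpha}n)\ne0\wedge|\varphi(\overline{\alpha}n)\dot-1|\le2^{ -k})$; (C3) for all $s$ and $i\in\{0,1,2\}$, $\varphi(s)\ne0\to(\varphi(s*\langle i\rangle)\ne0\wedge\varphi(s*\langle i\rangle)\dot-1\sqsubseteq\varphi(s)\dot-1)$; (C4) for all $s,t$, $(\varphi(s)\ne0\wedge\varphi(t)\ne0\wedge\mathbb{I}_s\approx\mathbb{I}_t)\to\varphi(s)\dot-1\approx\varphi(t)\dot-1$. - For a code $\varphi$, let $h_k(\alpha)$ be the least $n$ with $\varphi(\overline{\alpha}n)\ne0$ and $|\varphi(\overline{\alpha}n)\dot-1|\le2^{ -k}$. Let $f^\varphi_T(\alpha)=\langle\varphi(\overline{\alpha}h_n(\alpha))\dot-1\rangle_n$. This is a shrinking sequence of intervals $\langle\mathbb{J}_n\rangle$: $\mathbb{J}_{n+1}\sqsubseteq\mathbb{J}_n$ and $\forall k\,\exists n\,|\mathbb{J}_n|\le2^{ -k}$. - A shrinking sequence determines the real number $\langle\text{left endpoint of }\mathbb{J}_{\delta(n)}\rangle_n$, where $\delta(k)$ is the least $n$ with $|\mathbb{J}_n|\le2^{ -(k+1)}$.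 - $f$ is induced by $\varphi$ if for every $\alpha\in\{0,1,2\}^{\mathbb{N}}$, $f(\Phi(\alpha))$ equals the real number determined by $f^\varphi_T(\alpha)$. -}

module Defs where

open import Data.Nat as ℕ using (ℕ; zero; suc; _∸_; _<_)
open import Data.Integer using (+_)
open import Data.Rational using (ℚ; 0ℚ; 1ℚ; ½; _+_; _*_; _-_; ∣_∣; _≤_; _/_)
open import Data.Rational.Properties using (_≤?_)
open import Data.Fin using (Fin; toℕ)
open import Data.List using (List; []; _∷_; _++_; [_]; foldl; length; applyUpTo)
open import Data.Maybe using (Maybe; just; nothing)
open import Data.Product using (Σ; _×_; _,_; proj₁; proj₂)
open import Data.Empty using (⊥)
open import Relation.Nullary using (Dec; yes; no)
open import Relation.Binary.PropositionalEquality using (_≡_)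

2^- : ℕ → ℚ
2^- zero    = 1ℚ
2^- (suc k) = ½ * 2^- k

ℕ→ℚ : ℕ → ℚ
ℕ→ℚ n = + n / 1

Seq : Set
Seq = ℕ → ℚ

IsRegular : Seq → Set
IsRegular r = ∀ n → ∣ r n - r (suc n) ∣ ≤ 2^- (suc n)

record ℝ : Set where
  field
    seq : Seq
    reg : IsRegular seq
open ℝ public

infix 4 _≃_
_≃_ : Seq → Seq → Set
r ≃ q = ∀ n → ∣ r (suc n) - q (suc n) ∣ ≤ 2^- n

const : ℚ → Seq
const a _ = a

_-ℝ_ : Seq → Seq → Seq
(x -ℝ y) n = x (suc n) - y (suc n)

absℝ : Seq → Seq
absℝ x n = ∣ x n ∣

-- x ≤ y for reals with |x_n - x| ≤ 2^{-n}:  ∀ n, x_n ≤ y_n + 2·2^{-n}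
_≤ℝ_ : Seq → Seq → Set
x ≤ℝ y = ∀ n → x n ≤ y n + (2^- n + 2^- n)

Dist≤ : Seq → Seq → ℕ → Set
Dist≤ x y k = absℝ (x -ℝ y) ≤ℝ const (2^- k)

InUnit : Seq → Set
InUnit x = IsRegular x × (∀ n → (0ℚ ≤ x n) × (x n ≤ 1ℚ))

UnitFun : Set
UnitFun = (x : Seq) → InUnit x → ℝ

RespectsEq : UnitFun → Set
RespectsEq f = ∀ x y (px : InUnit x) (py : InUnit y) → x ≃ y → seq (f x px) ≃ seq (f y py)

ModulusFn : Set
ModulusFn = ℕ → (x : Seq) → InUnit x → ℕ

IsModulus : UnitFun → ModulusFn → Set
IsModulus f g = ∀ k x y (px : InUnit x) (py : InUnit y) →
  Dist≤ x y (g k x px) → Dist≤ (seq (f x px)) (seq (f y py)) k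

IsContinuousModulus : ModulusFn → Set
IsContinuousModulus g = ∀ k x (px : InUnit x) → Σ ℕ λ n →
  ∀ y (py : InUnit y) → (∀ i → i < n → x i ≡ y i) → g k x px ≡ g k y py

Str : Set
Str = List (Fin 3)

-- N(⟨⟩) = 1, N(s * ⟨i⟩) = 2 N(s) + (i - 1)   (N(s) ≥ 1, so ∸ is exact)
N : Str → ℕ
N = foldl (λ acc i → (2 ℕ.* acc ℕ.+ toℕ i) ∸ 1) 1

bar : (ℕ → Fin 3) → ℕ → Str
bar α n = applyUpTo α n

Φ : (ℕ → Fin 3) → Seq
Φ α n = 2^- (suc n) * ℕ→ℚ (N (bar α n))

-- Rational intervals (p , q) ; 𝕋 membership is p ≤ q

Interval : Set
Interval = ℚ × ℚ

left : Interval → ℚ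
left = proj₁

width : Interval → ℚ
width (p , q) = q - p

_⊑_ : Interval → Interval → Set
(p , q) ⊑ (p' , q') = (p' ≤ p) × (q ≤ q')

_≈I_ : Interval → Interval → Set
(p , q) ≈I (p' , q') = (p' ≤ q) × (p ≤ q')

𝕀 : Str → Interval
𝕀 s = (2^- (suc (length s)) * (ℕ→ℚ (N s) - 1ℚ)) , (2^- (suc (length s)) * (ℕ→ℚ (N s) + 1ℚ))

-- Codes.  φ(s) = 0 is rendered as nothing, φ(s) ≠ 0 with φ(s) ∸ 1 = I as just I.

PreCode : Set
PreCode = Str → Maybe Interval

Good : Maybe Interval → ℕ → Set
Good nothing  k = ⊥
Good (just I) k = width I ≤ 2^- k

good? : ∀ m k → Dec (Good m k)
good? nothing  k = no (λ ())
good? (just I) k = width I ≤? 2^- k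

record IsCode (φ : PreCode) : Set where
  field
    C1 : ∀ s p q → φ s ≡ just (p , q) → p ≤ q
    C2 : ∀ k (α : ℕ → Fin 3) → Σ ℕ λ n → Good (φ (bar α n)) k
    C3 : ∀ s (i : Fin 3) I → φ s ≡ just I →
         Σ Interval λ I' → (φ (s ++ [ i ]) ≡ just I') × (I' ⊑ I)
    C4 : ∀ s t I J → φ s ≡ just I → φ t ≡ just J → 𝕀 s ≈I 𝕀 t → I ≈I J

private
  scan : {P : ℕ → Set} → (∀ n → Dec (P n)) → ℕ → Maybe (Σ ℕ P)
  scan d zero = nothing
  scan d (suc n) with scan d n
  ... | just r  = just r
  ... | nothing with d n
  ...   | yes p = just (n , p)
  ...   | no _  = nothing

least : {P : ℕ → Set} → (∀ n → Dec (P n)) → Σ ℕ P → Σ ℕ P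
least d (n , p) with scan d n
... | just r  = r
... | nothing = (n , p)

extract : ∀ m k → Good m k → Σ Interval λ I → width I ≤ 2^- k
extract (just I) k w = I , w

module _ {φ : PreCode} (c : IsCode φ) (α : ℕ → Fin 3) where
  open IsCode c

  hGood : (k : ℕ) → Σ ℕ λ n → Good (φ (bar α n)) k
  hGood k = least (λ n → good? (φ (bar α n)) k) (C2 k α)

  h : ℕ → ℕ
  h k = proj₁ (hGood k)

  𝕁w : (k : ℕ) → Σ Interval λ I → width I ≤ 2^- k
  𝕁w k = extract (φ (bar α (h k))) k (proj₂ (hGood k))

  𝕁 : ℕ → Interval
  𝕁 k = proj₁ (𝕁w k)

  δ : ℕ → ℕ
  δ k = proj₁ (least (λ n → width (𝕁 n) ≤? 2^- (suc k)) (suc k , proj₂ (𝕁w (suc k))))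

  determinedReal : Seq
  determinedReal n = left (𝕁 (δ n))

InducedBy : UnitFun → (φ : PreCode) → IsCode φ → Set
InducedBy f φ c = ∀ (α : ℕ → Fin 3) (pα : InUnit (Φ α)) →
  seq (f (Φ α) pα) ≃ determinedReal c α

module Submission where

-- Around each node s of the ternary tree sits a ball of radius 2^-(|s|+1); take as its sample
-- point Φ of s padded with 1s. Once the modulus g (k+2) at the sample is at most |s|, f maps
-- the whole ball into the interval of radius 2^-(k+1) around the rational f(sample)_(k+2).
-- The code φ(s) is the intersection of all such intervals collected along the prefixes of s
-- (undefined while there are none). Since each collected interval contains f of the whole
-- ball, φ(s) is nonempty, overlapping nodes get overlapping intervals, and f(Φ α) lies in
-- every φ(ᾱn); intersecting along prefixes makes φ monotone; and continuity of the modulus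
-- makes the estimate of precision k admissible at a finite depth along every α, which gives
-- (C2) and pins the real determined by f^φ_T(α) down to f(Φ α).


open import Defs
open import Data.Product using (Σ; _×_; _,_; proj₁; proj₂)
open import Data.Nat as ℕ using (ℕ; zero; suc)
import Data.Nat.Properties as ℕP
open import Data.Integer as ℤ using (+[1+_]; -[1+_])
import Data.Integer.Properties as ℤP
open import Data.Nat.Coprimality using (Coprime)
open import Data.Rational
  using (ℚ; mkℚ; 0ℚ; 1ℚ; ½; _+_; _*_; _-_; -_; ∣_∣; _≤_; _⊓_; _⊔_; Positive; toℚᵘ)
open import Data.Rational.Properties
open import Data.Rational.Unnormalised as ℚᵘ using (mkℚᵘ; *≡*)
import Data.Rational.Unnormalised.Properties as ℚᵘP
open import Data.Rational.Solver using (module +-*-Solver)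
open import Data.Sum using (inj₁; inj₂; [_,_]′)
open import Data.Empty using (⊥-elim)
open import Function using (_∘_)
open import Relation.Nullary using (Dec)
open import Data.Maybe using (Maybe; just; nothing)
open import Data.Fin as Fin using (Fin; toℕ)
open import Data.List using (List; []; _∷_; _++_; [_]; _∷ʳ_; foldl; length; applyUpTo; reverse; map; filter; upTo)
open import Data.List.Reverse using (Reverse; _∶_∶ʳ_; reverseView)
import Data.List.Properties as ListP
open import Data.List.Relation.Unary.Any using (here; there)
open import Data.List.Membership.Propositional using (_∈_)
open import Data.List.Membership.Propositional.Properties using (∈-++⁺ʳ; ∈-++⁻; ∈-upTo⁺; ∈-map∘filter⁺; ∈-map∘filter⁻)
open import Relation.Binary.PropositionalEquality hiding ([_])

open +-*-Solver

2^-suc+2^-suc : ∀ n → 2^- (suc n) + 2^- (suc n) ≡ 2^- n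
2^-suc+2^-suc n = trans (sym (*-distribʳ-+ (2^- n) ½ ½)) (*-identityˡ (2^- n))

2^--positive : ∀ n → Positive (2^- n)
2^--positive zero    = _
2^--positive (suc n) = pos*pos⇒pos ½ (2^- n) {{2^--positive n}}

0≤2^- : ∀ n → 0ℚ ≤ 2^- n
0≤2^- n = <⇒≤ (positive⁻¹ (2^- n) {{2^--positive n}})

p≤p+q : ∀ p q → 0ℚ ≤ q → p ≤ p + q
p≤p+q p q 0≤q = ≤-trans (≤-reflexive (sym (+-identityʳ p))) (+-monoʳ-≤ p 0≤q)

2^-suc≤2^- : ∀ n → 2^- (suc n) ≤ 2^- n
2^-suc≤2^- n = ≤-trans (p≤p+q _ _ (0≤2^- (suc n))) (≤-reflexive (2^-suc+2^-suc n))

2^--antimono : ∀ {m n} → m ℕ.≤ n → 2^- n ≤ 2^- m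
2^--antimono {zero}  {zero}  ℕ.z≤n     = ≤-refl
2^--antimono {zero}  {suc n} ℕ.z≤n     = ≤-trans (2^-suc≤2^- n) (2^--antimono {zero} {n} ℕ.z≤n)
2^--antimono {suc m} {suc n} (ℕ.s≤s p) = *-monoˡ-≤-nonNeg ½ (2^--antimono p)

ℕ→ℚ≃ : ∀ m → toℚᵘ (ℕ→ℚ m) ℚᵘ.≃ mkℚᵘ (ℤ.+ m) 0
ℕ→ℚ≃ m = toℚᵘ-fromℚᵘ (mkℚᵘ (ℤ.+ m) 0)

ℕ→ℚ-+ : ∀ m n → ℕ→ℚ (m ℕ.+ n) ≡ ℕ→ℚ m + ℕ→ℚ n
ℕ→ℚ-+ m n = toℚᵘ-injective (begin
  toℚᵘ (ℕ→ℚ (m ℕ.+ n))                  ≈⟨ ℕ→ℚ≃ (m ℕ.+ n) ⟩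
  mkℚᵘ (ℤ.+ (m ℕ.+ n)) 0                 ≈⟨ *≡* (cong₂ ℤ._*_ (sym (cong₂ ℤ._+_ (ℤP.*-identityʳ (ℤ.+ m)) (ℤP.*-identityʳ (ℤ.+ n)))) refl) ⟩
  mkℚᵘ (ℤ.+ m) 0 ℚᵘ.+ mkℚᵘ (ℤ.+ n) 0     ≈⟨ ℚᵘP.+-cong (ℚᵘP.≃-sym (ℕ→ℚ≃ m)) (ℚᵘP.≃-sym (ℕ→ℚ≃ n)) ⟩
  toℚᵘ (ℕ→ℚ m) ℚᵘ.+ toℚᵘ (ℕ→ℚ n)         ≈⟨ ℚᵘP.≃-sym (toℚᵘ-homo-+ (ℕ→ℚ m) (ℕ→ℚ n)) ⟩
  toℚᵘ (ℕ→ℚ m + ℕ→ℚ n)                  ∎)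
  where open ℚᵘP.≃-Reasoning

0≤ℕ→ℚ : ∀ n → 0ℚ ≤ ℕ→ℚ n
0≤ℕ→ℚ n = nonNegative⁻¹ (ℕ→ℚ n) {{normalize-nonNeg n 1}}

n*2^-n≤1 : ∀ n → ℕ→ℚ n * 2^- n ≤ 1ℚ
n*2^-n≤1 zero    = ≤ᵇ⇒≤ _
n*2^-n≤1 (suc n) = begin
  ℕ→ℚ (suc n) * (½ * 2^- n)             ≡⟨ cong (_* (½ * 2^- n)) (ℕ→ℚ-+ 1 n) ⟩
  (1ℚ + ℕ→ℚ n) * (½ * 2^- n)            ≡⟨ solve 3 (λ N h x → (con 1ℚ :+ N) :* (h :* x) := h :* (N :* x) :+ h :* x) refl (ℕ→ℚ n) ½ (2^- n) ⟩
  ½ * (ℕ→ℚ n * 2^- n) + ½ * 2^- n       ≤⟨ +-mono-≤ (*-monoˡ-≤-nonNeg ½ (n*2^-n≤1 n)) (*-monoˡ-≤-nonNeg ½ (2^--antimono {0} {n} ℕ.z≤n)) ⟩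
  1ℚ                                   ∎
  where open ≤-Reasoning

ℕ→ℚ-*-mkℚ : ∀ a b .(c : Coprime (suc a) (suc b)) → ℕ→ℚ (suc b) * mkℚ +[1+ a ] b c ≡ ℕ→ℚ (suc a)
ℕ→ℚ-*-mkℚ a b c = toℚᵘ-injective (begin
  toℚᵘ (ℕ→ℚ (suc b) * mkℚ +[1+ a ] b c)              ≈⟨ toℚᵘ-homo-* (ℕ→ℚ (suc b)) (mkℚ +[1+ a ] b c) ⟩
  toℚᵘ (ℕ→ℚ (suc b)) ℚᵘ.* mkℚᵘ +[1+ a ] b             ≈⟨ ℚᵘP.*-cong (ℕ→ℚ≃ (suc b)) ℚᵘP.≃-refl ⟩
  mkℚᵘ (ℤ.+ suc b) 0 ℚᵘ.* mkℚᵘ +[1+ a ] b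
    ≈⟨ *≡* (trans (ℤP.*-identityʳ _) (trans (ℤP.*-comm (ℤ.+ suc b) (ℤ.+ suc a))
                                            (cong (λ z → ℤ.+ suc a ℤ.* ℤ.+ suc z) (sym (ℕP.+-identityʳ b))))) ⟩
  mkℚᵘ (ℤ.+ suc a) 0                                  ≈⟨ ℚᵘP.≃-sym (ℕ→ℚ≃ (suc a)) ⟩
  toℚᵘ (ℕ→ℚ (suc a))                                  ∎)
  where open ℚᵘP.≃-Reasoning

-- A positive d = (a+1)/(b+1) satisfies 2 ≤ (b+1)·(d+d), while (b+1)·2^-(b+1) ≤ 1.
≤2^-⇒≤0 : ∀ d → (∀ n → d ≤ 2^- n) → d ≤ 0ℚ
≤2^-⇒≤0 (mkℚ -[1+ _ ] _ _) _ = nonPositive⁻¹ _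
≤2^-⇒≤0 (mkℚ (ℤ.+ 0) _ _) _ = nonPositive⁻¹ _
≤2^-⇒≤0 d@(mkℚ +[1+ a ] b c) d≤2^- = ⊥-elim (≤⇒≤ᵇ 2≤1)
  where
  open ≤-Reasoning
  B = ℕ→ℚ (suc b)
  1≤a+1 : 1ℚ ≤ ℕ→ℚ (suc a)
  1≤a+1 = ≤-trans (p≤p+q 1ℚ (ℕ→ℚ a) (0≤ℕ→ℚ a)) (≤-reflexive (sym (ℕ→ℚ-+ 1 a)))
  2≤1 : 1ℚ + 1ℚ ≤ 1ℚ
  2≤1 = begin
    1ℚ + 1ℚ                         ≤⟨ +-mono-≤ 1≤a+1 1≤a+1 ⟩
    ℕ→ℚ (suc a) + ℕ→ℚ (suc a)       ≡⟨ sym (trans (*-distribˡ-+ B d d) (cong₂ _+_ (ℕ→ℚ-*-mkℚ a b c) (ℕ→ℚ-*-mkℚ a b c))) ⟩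
    B * (d + d)                     ≤⟨ *-monoˡ-≤-nonNeg B {{normalize-nonNeg (suc b) 1}} (+-mono-≤ (d≤2^- (suc (suc b))) (d≤2^- (suc (suc b)))) ⟩
    B * (2^- (suc (suc b)) + 2^- (suc (suc b)))  ≡⟨ cong (B *_) (2^-suc+2^-suc (suc b)) ⟩
    B * 2^- (suc b)                 ≤⟨ n*2^-n≤1 (suc b) ⟩
    1ℚ                              ∎

p-q≤r⇒p≤q+r : ∀ {p q r} → p - q ≤ r → p ≤ q + r
p-q≤r⇒p≤q+r {p} {q} {r} p-q≤r = begin
  p              ≡⟨ solve 2 (λ p q → p := (p :- q) :+ q) refl p q ⟩
  (p - q) + q    ≤⟨ +-monoˡ-≤ q p-q≤r ⟩
  r + q          ≡⟨ +-comm r q ⟩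
  q + r          ∎
  where open ≤-Reasoning

p≤q+r⇒p-q≤r : ∀ {p q r} → p ≤ q + r → p - q ≤ r
p≤q+r⇒p-q≤r {p} {q} {r} p≤q+r = ≤-trans (+-monoˡ-≤ (- q) p≤q+r)
  (≤-reflexive (solve 2 (λ q r → (q :+ r) :- q := r) refl q r))

≤-by-2^- : ∀ {p q} → (∀ m → p ≤ q + 2^- m) → p ≤ q
≤-by-2^- {p} {q} p≤q+2^- = ≤-trans (p-q≤r⇒p≤q+r (≤2^-⇒≤0 (p - q) (λ m → p≤q+r⇒p-q≤r (p≤q+2^- m))))
  (≤-reflexive (+-identityʳ q))

p≤∣p∣ : ∀ p → p ≤ ∣ p ∣
p≤∣p∣ p with ∣p∣≡p∨∣p∣≡-p p
... | inj₁ ∣p∣≡p  = ≤-reflexive (sym ∣p∣≡p)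
... | inj₂ ∣p∣≡-p = ≤-trans p≤0 (0≤∣p∣ p)
  where
  p≤0 : p ≤ 0ℚ
  p≤0 = ≤-trans (≤-reflexive (solve 1 (λ p → p := :- (:- p)) refl p))
    (neg-antimono-≤ (≤-trans (0≤∣p∣ p) (≤-reflexive ∣p∣≡-p)))

p≤r⇒-p≤r⇒∣p∣≤r : ∀ {p r} → p ≤ r → - p ≤ r → ∣ p ∣ ≤ r
p≤r⇒-p≤r⇒∣p∣≤r {p} p≤r -p≤r with ∣p∣≡p∨∣p∣≡-p p
... | inj₁ ∣p∣≡p  = ≤-trans (≤-reflexive ∣p∣≡p) p≤r
... | inj₂ ∣p∣≡-p = ≤-trans (≤-reflexive ∣p∣≡-p) -p≤r

Close : ℚ → ℚ → ℚ → Set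
Close a b ε = (a ≤ b + ε) × (b ≤ a + ε)

∣-∣≤⇒Close : ∀ {a b ε} → ∣ a - b ∣ ≤ ε → Close a b ε
∣-∣≤⇒Close {a} {b} ∣a-b∣≤ε =
  p-q≤r⇒p≤q+r (≤-trans (p≤∣p∣ (a - b)) ∣a-b∣≤ε) ,
  p-q≤r⇒p≤q+r (≤-trans (p≤∣p∣ (b - a)) (≤-trans (≤-reflexive ∣b-a∣≡∣a-b∣) ∣a-b∣≤ε))
  where
  ∣b-a∣≡∣a-b∣ : ∣ b - a ∣ ≡ ∣ a - b ∣
  ∣b-a∣≡∣a-b∣ = trans (cong ∣_∣ (solve 2 (λ a b → b :- a := :- (a :- b)) refl a b)) (∣-p∣≡∣p∣ (a - b))

Close⇒∣-∣≤ : ∀ {a b ε} → Close a b ε → ∣ a - b ∣ ≤ ε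
Close⇒∣-∣≤ {a} {b} (a≤ , b≤) = p≤r⇒-p≤r⇒∣p∣≤r (p≤q+r⇒p-q≤r a≤)
  (≤-trans (≤-reflexive (solve 2 (λ a b → :- (a :- b) := b :- a) refl a b)) (p≤q+r⇒p-q≤r b≤))

Close-sym : ∀ {a b ε} → Close a b ε → Close b a ε
Close-sym (a≤ , b≤) = b≤ , a≤

Close-trans : ∀ {a b c ε δ} → Close a b ε → Close b c δ → Close a c (ε + δ)
Close-trans {a} {b} {c} {ε} {δ} (a≤ , b≤) (b≤′ , c≤) =
  ≤-trans a≤ (≤-trans (+-monoˡ-≤ ε b≤′) (≤-reflexive (trans (+-assoc c δ ε) (cong (c +_) (+-comm δ ε))))) ,
  ≤-trans c≤ (≤-trans (+-monoˡ-≤ δ b≤) (≤-reflexive (+-assoc a ε δ)))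

Close-mono : ∀ {a b ε δ} → ε ≤ δ → Close a b ε → Close a b δ
Close-mono {a} {b} ε≤δ (a≤ , b≤) = ≤-trans a≤ (+-monoʳ-≤ b ε≤δ) , ≤-trans b≤ (+-monoʳ-≤ a ε≤δ)

Close-refl : ∀ {a ε} → 0ℚ ≤ ε → Close a a ε
Close-refl {a} {ε} 0≤ε = p≤p+q a ε 0≤ε , p≤p+q a ε 0≤ε

Close-by-2^- : ∀ {a b ε} → (∀ m → Close a b (ε + 2^- m)) → Close a b ε
Close-by-2^- {a} {b} {ε} close =
  ≤-by-2^- (λ m → ≤-trans (proj₁ (close m)) (≤-reflexive (sym (+-assoc b ε (2^- m))))) ,
  ≤-by-2^- (λ m → ≤-trans (proj₂ (close m)) (≤-reflexive (sym (+-assoc a ε (2^- m)))))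

Close-offset : ∀ {a b h} (i : Fin 3) → 0ℚ ≤ h → a + h ≡ b + h * ℕ→ℚ (toℕ i) → Close a b h
Close-offset {a} {b} {h} Fin.zero 0≤h a+h≡b =
  ≤-trans (p≤p+q a h 0≤h) (≤-trans (p≤p+q (a + h) h 0≤h) (≤-reflexive (cong (_+ h) a+h≡b′))) ,
  ≤-reflexive (sym a+h≡b′)
  where
  a+h≡b′ : a + h ≡ b
  a+h≡b′ = trans a+h≡b (solve 2 (λ b h → b :+ h :* con 0ℚ := b) refl b h)
Close-offset {a} {b} {h} (Fin.suc Fin.zero) 0≤h a+h≡b+h = subst (λ c → Close a c h) a≡b (Close-refl 0≤h)
  where
  a≡b : a ≡ b
  a≡b = trans (solve 2 (λ a h → a := (a :+ h) :- h) refl a h)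
              (trans (cong (_- h) a+h≡b+h) (solve 2 (λ b h → (b :+ h :* con 1ℚ) :- h := b) refl b h))
Close-offset {a} {b} {h} (Fin.suc (Fin.suc Fin.zero)) 0≤h a+h≡b+2h =
  ≤-reflexive a≡b+h , ≤-trans (p≤p+q b h 0≤h) (≤-trans (p≤p+q (b + h) h 0≤h) (≤-reflexive (cong (_+ h) (sym a≡b+h))))
  where
  a≡b+h : a ≡ b + h
  a≡b+h = trans (solve 2 (λ a h → a := (a :+ h) :- h) refl a h)
                (trans (cong (_- h) a+h≡b+2h) (solve 2 (λ b h → (b :+ h :* (con 1ℚ :+ con 1ℚ)) :- h := b :+ h) refl b h))

Close⇒ball-⊑ : ∀ {c′ c ρ} → Close c′ c ρ → (c′ - ρ , c′ + ρ) ⊑ (c - (ρ + ρ) , c + (ρ + ρ))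
Close⇒ball-⊑ {c′} {c} {ρ} (c′≤ , c≤) =
  ≤-trans (+-monoˡ-≤ (- (ρ + ρ)) c≤) (≤-reflexive (solve 2 (λ c′ ρ → c′ :+ ρ :- (ρ :+ ρ) := c′ :- ρ) refl c′ ρ)) ,
  ≤-trans (+-monoˡ-≤ ρ c′≤) (≤-reflexive (+-assoc c ρ ρ))

Halving : (ℕ → ℚ) → Set
Halving w = ∀ n → w (suc n) + w (suc n) ≡ w n

Close-telescope : ∀ {w} → Halving w → ∀ {s : ℕ → ℚ} →
                  (∀ n → Close (s n) (s (suc n)) (w (suc n))) →
                  ∀ n j → Close (s n) (s (j ℕ.+ n)) (w n - w (j ℕ.+ n))
Close-telescope {w} halving step n zero    = Close-refl (≤-reflexive (sym (+-inverseʳ (w n))))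
Close-telescope {w} halving step n (suc j) =
  Close-mono (≤-reflexive sum≡) (Close-trans (Close-telescope halving step n j) (step (j ℕ.+ n)))
  where
  sum≡ : w n - w (j ℕ.+ n) + w (suc j ℕ.+ n) ≡ w n - w (suc j ℕ.+ n)
  sum≡ = begin
    w n - w (j ℕ.+ n) + w (suc j ℕ.+ n)                             ≡⟨ cong (λ z → w n - z + w (suc j ℕ.+ n)) (sym (halving (j ℕ.+ n))) ⟩
    w n - (w (suc j ℕ.+ n) + w (suc j ℕ.+ n)) + w (suc j ℕ.+ n)     ≡⟨ solve 2 (λ v u → v :- (u :+ u) :+ u := v :- u) refl (w n) (w (suc j ℕ.+ n)) ⟩
    w n - w (suc j ℕ.+ n)                                           ∎
    where open ≡-Reasoning

Close-steps : ∀ {w} → Halving w → (∀ n → 0ℚ ≤ w n) → ∀ {s : ℕ → ℚ} →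
              (∀ n → Close (s n) (s (suc n)) (w (suc n))) →
              ∀ n m → Close (s n) (s m) (w n + w m)
Close-steps {w} halving 0≤w {s} step n m =
  [ ordered , (λ m≤n → Close-sym (Close-mono (≤-reflexive (+-comm (w m) (w n))) (ordered m≤n))) ]′
  (ℕP.≤-total n m)
  where
  ordered : ∀ {n m} → n ℕ.≤ m → Close (s n) (s m) (w n + w m)
  ordered {n} {m} n≤m = Close-mono (+-monoʳ-≤ (w n) (≤-trans (neg-antimono-≤ (0≤w m)) (0≤w m)))
    (subst (λ k → Close (s n) (s k) (w n - w k)) (ℕP.m∸n+n≡m n≤m) (Close-telescope halving step n (m ℕ.∸ n)))

regular⇒Close : ∀ {r} → IsRegular r → ∀ n m → Close (r n) (r m) (2^- n + 2^- m)
regular⇒Close reg = Close-steps 2^-suc+2^-suc 0≤2^- (λ n → ∣-∣≤⇒Close (reg n))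

-- Pass from x n to y j through x and y at the index M + 3, then let M grow.
Dist≤⇒Close : ∀ {x y k} → IsRegular x → IsRegular y → Dist≤ x y k →
              ∀ n j → Close (x n) (y j) ((2^- n + 2^- j) + 2^- k)
Dist≤⇒Close {x} {y} {k} regx regy x≈y n j = Close-by-2^- {x n} {y j} λ M →
  Close-mono (error≤ M)
    (Close-trans (Close-trans (regular⇒Close {x} regx n (3+ M)) (∣-∣≤⇒Close (x≈y (2+ M))))
                 (regular⇒Close {y} regy (3+ M) j))
  where
  2+ 3+ : ℕ → ℕ
  2+ M = suc (suc M)
  3+ M = suc (2+ M)
  error≤ : ∀ M → ((2^- n + 2^- (3+ M)) + (2^- k + (2^- (2+ M) + 2^- (2+ M)))) + (2^- (3+ M) + 2^- j)
                 ≤ ((2^- n + 2^- j) + 2^- k) + 2^- M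
  error≤ M = begin
    ((2^- n + e₃) + (2^- k + (e₂ + e₂))) + (e₃ + 2^- j)
      ≡⟨ solve 5 (λ a b c u v → ((a :+ u) :+ (c :+ (v :+ v))) :+ (u :+ b) := ((a :+ b) :+ c) :+ ((u :+ u) :+ (v :+ v)))
                 refl (2^- n) (2^- j) (2^- k) e₃ e₂ ⟩
    ((2^- n + 2^- j) + 2^- k) + ((e₃ + e₃) + (e₂ + e₂))  ≡⟨ cong (((2^- n + 2^- j) + 2^- k) +_) (cong₂ _+_ (2^-suc+2^-suc (2+ M)) (2^-suc+2^-suc (suc M))) ⟩
    ((2^- n + 2^- j) + 2^- k) + (e₂ + 2^- (suc M))      ≤⟨ +-monoʳ-≤ ((2^- n + 2^- j) + 2^- k) (+-monoˡ-≤ (2^- (suc M)) (2^-suc≤2^- (suc M))) ⟩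
    ((2^- n + 2^- j) + 2^- k) + (2^- (suc M) + 2^- (suc M))  ≡⟨ cong (((2^- n + 2^- j) + 2^- k) +_) (2^-suc+2^-suc M) ⟩
    ((2^- n + 2^- j) + 2^- k) + 2^- M                  ∎
    where
    open ≤-Reasoning
    e₂ = 2^- (2+ M)
    e₃ = 2^- (3+ M)

Dist≤-mono : ∀ {x y m k} → m ℕ.≤ k → Dist≤ x y k → Dist≤ x y m
Dist≤-mono {m = m} m≤k x≈y n = ≤-trans (x≈y n) (+-monoˡ-≤ (2^- n + 2^- n) (2^--antimono m≤k))

InBall : Seq → ℚ → ℚ → Set
InBall x c r = ∀ n → Close (x n) c (r + 2^- n)

InBall⇒Dist≤ : ∀ {x y c k} → InBall x c (2^- (suc k)) → InBall y c (2^- (suc k)) → Dist≤ x y k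
InBall⇒Dist≤ {x} {y} {c} {k} x∈B y∈B n =
  Close⇒∣-∣≤ (Close-mono error≤ (Close-trans (x∈B (suc n)) (Close-sym (y∈B (suc n)))))
  where
  error≤ : (2^- (suc k) + 2^- (suc n)) + (2^- (suc k) + 2^- (suc n)) ≤ 2^- k + (2^- n + 2^- n)
  error≤ = begin
    (2^- (suc k) + 2^- (suc n)) + (2^- (suc k) + 2^- (suc n))  ≡⟨ solve 2 (λ a b → (a :+ b) :+ (a :+ b) := (a :+ a) :+ (b :+ b)) refl (2^- (suc k)) (2^- (suc n)) ⟩
    (2^- (suc k) + 2^- (suc k)) + (2^- (suc n) + 2^- (suc n))  ≡⟨ cong₂ _+_ (2^-suc+2^-suc k) (2^-suc+2^-suc n) ⟩
    2^- k + 2^- n                                               ≤⟨ +-monoʳ-≤ (2^- k) (p≤p+q (2^- n) (2^- n) (0≤2^- n)) ⟩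
    2^- k + (2^- n + 2^- n)                                     ∎
    where open ≤-Reasoning

const-InUnit : ∀ {z} → 0ℚ ≤ z → z ≤ 1ℚ → InUnit (const z)
const-InUnit {z} 0≤z z≤1 = (λ n → ≤-trans (≤-reflexive (cong ∣_∣ (+-inverseʳ z))) (0≤2^- (suc n))) , λ _ → 0≤z , z≤1

infix 4 _∈ᴵ_
_∈ᴵ_ : Seq → Interval → Set
x ∈ᴵ I = ∀ n → (proj₁ I ≤ x n + 2^- n) × (x n ≤ proj₂ I + 2^- n)

∈ᴵ-overlap : ∀ {x I J} → x ∈ᴵ I → x ∈ᴵ J → proj₁ J ≤ proj₂ I
∈ᴵ-overlap {x} {I} {J} x∈I x∈J = ≤-by-2^- λ n → begin
  proj₁ J                                     ≤⟨ proj₁ (x∈J (suc n)) ⟩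
  x (suc n) + 2^- (suc n)                     ≤⟨ +-monoˡ-≤ (2^- (suc n)) (proj₂ (x∈I (suc n))) ⟩
  (proj₂ I + 2^- (suc n)) + 2^- (suc n)       ≡⟨ trans (+-assoc (proj₂ I) _ _) (cong (proj₂ I +_) (2^-suc+2^-suc n)) ⟩
  proj₂ I + 2^- n                             ∎
  where open ≤-Reasoning

Close⇒∈ᴵ : ∀ {x a r} → (∀ n → Close (x n) a (2^- n + r)) → x ∈ᴵ (a - r , a + r)
Close⇒∈ᴵ {x} {a} {r} close n =
  ≤-trans (+-monoˡ-≤ (- r) (proj₂ (close n)))
          (≤-reflexive (solve 3 (λ x e r → x :+ (e :+ r) :- r := x :+ e) refl (x n) (2^- n) r)) ,
  ≤-trans (proj₁ (close n)) (≤-reflexive (solve 3 (λ a e r → a :+ (e :+ r) := a :+ r :+ e) refl a (2^- n) r))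

left-endpoint-approximates : ∀ {x J} n → x ∈ᴵ J → width J ≤ 2^- (suc (suc n)) →
                             ∣ x (suc n) - left J ∣ ≤ 2^- n
left-endpoint-approximates {x} {J} n x∈J narrow = Close⇒∣-∣≤ (Close-mono e₁+e₂≤ (above , below))
  where
  open ≤-Reasoning
  e₁ = 2^- (suc n)
  e₂ = 2^- (suc (suc n))
  above : x (suc n) ≤ left J + (e₁ + e₂)
  above = begin
    x (suc n)               ≤⟨ proj₂ (x∈J (suc n)) ⟩
    proj₂ J + e₁            ≤⟨ +-monoˡ-≤ e₁ (p-q≤r⇒p≤q+r {proj₂ J} {left J} narrow) ⟩
    (left J + e₂) + e₁      ≡⟨ solve 3 (λ p a b → p :+ b :+ a := p :+ (a :+ b)) refl (left J) e₁ e₂ ⟩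
    left J + (e₁ + e₂)      ∎
  below : left J ≤ x (suc n) + (e₁ + e₂)
  below = begin
    left J                  ≤⟨ proj₁ (x∈J (suc n)) ⟩
    x (suc n) + e₁          ≤⟨ p≤p+q _ e₂ (0≤2^- (suc (suc n))) ⟩
    x (suc n) + e₁ + e₂     ≡⟨ +-assoc (x (suc n)) e₁ e₂ ⟩
    x (suc n) + (e₁ + e₂)   ∎
  e₁+e₂≤ : e₁ + e₂ ≤ 2^- n
  e₁+e₂≤ = ≤-trans (+-monoʳ-≤ e₁ (2^-suc≤2^- (suc n))) (≤-reflexive (2^-suc+2^-suc n))

⊑-refl : ∀ {I} → I ⊑ I
⊑-refl = ≤-refl , ≤-refl

⊑-trans : ∀ {I J K} → I ⊑ J → J ⊑ K → I ⊑ K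
⊑-trans (p≥ , q≤) (p′≥ , q′≤) = ≤-trans p′≥ p≥ , ≤-trans q≤ q′≤

⊑⇒width≤ : ∀ {I J} → I ⊑ J → width I ≤ width J
⊑⇒width≤ (p≥ , q≤) = +-mono-≤ q≤ (neg-antimono-≤ p≥)

infixl 30 _∩_
_∩_ : Interval → Interval → Interval
I ∩ J = proj₁ I ⊔ proj₁ J , proj₂ I ⊓ proj₂ J

∩-⊑ˡ : ∀ I J → I ∩ J ⊑ I
∩-⊑ˡ I J = p≤p⊔q (proj₁ I) (proj₁ J) , p⊓q≤p (proj₂ I) (proj₂ J)

∩-⊑ʳ : ∀ I J → I ∩ J ⊑ J
∩-⊑ʳ I J = p≤q⊔p (proj₁ I) (proj₁ J) , p⊓q≤q (proj₂ I) (proj₂ J)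

∈ᴵ-∩ : ∀ {x I J} → x ∈ᴵ I → x ∈ᴵ J → x ∈ᴵ I ∩ J
∈ᴵ-∩ {x} {I} {J} x∈I x∈J n = lower , upper
  where
  lower : proj₁ I ⊔ proj₁ J ≤ x n + 2^- n
  lower with ⊔-sel (proj₁ I) (proj₁ J)
  ... | inj₁ ⊔≡ = ≤-trans (≤-reflexive ⊔≡) (proj₁ (x∈I n))
  ... | inj₂ ⊔≡ = ≤-trans (≤-reflexive ⊔≡) (proj₁ (x∈J n))
  upper : x n ≤ proj₂ I ⊓ proj₂ J + 2^- n
  upper with ⊓-sel (proj₂ I) (proj₂ J)
  ... | inj₁ ⊓≡ = ≤-trans (proj₂ (x∈I n)) (≤-reflexive (cong (_+ 2^- n) (sym ⊓≡)))
  ... | inj₂ ⊓≡ = ≤-trans (proj₂ (x∈J n)) (≤-reflexive (cong (_+ 2^- n) (sym ⊓≡)))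

foldl-∩-⊑ : ∀ I Js → foldl _∩_ I Js ⊑ I
foldl-∩-⊑ I []       = ⊑-refl
foldl-∩-⊑ I (J ∷ Js) = ⊑-trans (foldl-∩-⊑ (I ∩ J) Js) (∩-⊑ˡ I J)

foldl-∩-⊑-∈ : ∀ I Js {J} → J ∈ Js → foldl _∩_ I Js ⊑ J
foldl-∩-⊑-∈ I (J ∷ Js) (here refl) = ⊑-trans (foldl-∩-⊑ (I ∩ J) Js) (∩-⊑ʳ I J)
foldl-∩-⊑-∈ I (K ∷ Js) (there J∈Js) = foldl-∩-⊑-∈ (I ∩ K) Js J∈Js

∈ᴵ-foldl-∩ : ∀ {x} I Js → x ∈ᴵ I → (∀ {J} → J ∈ Js → x ∈ᴵ J) → x ∈ᴵ foldl _∩_ I Js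
∈ᴵ-foldl-∩ I []       x∈I x∈Js = x∈I
∈ᴵ-foldl-∩ I (J ∷ Js) x∈I x∈Js = ∈ᴵ-foldl-∩ (I ∩ J) Js (∈ᴵ-∩ {I = I} {J = J} x∈I (x∈Js (here refl))) (x∈Js ∘ there)

⋂ : List Interval → Maybe Interval
⋂ []       = nothing
⋂ (I ∷ Is) = just (foldl _∩_ I Is)

∈ᴵ-⋂ : ∀ {x} Is {I} → ⋂ Is ≡ just I → (∀ {J} → J ∈ Is → x ∈ᴵ J) → x ∈ᴵ I
∈ᴵ-⋂ (J ∷ Js) refl x∈Is = ∈ᴵ-foldl-∩ J Js (x∈Is (here refl)) (x∈Is ∘ there)

⋂-++-⊑ : ∀ Is Js {I} → ⋂ Is ≡ just I → Σ Interval λ I′ → (⋂ (Is ++ Js) ≡ just I′) × (I′ ⊑ I)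
⋂-++-⊑ (K ∷ Ks) Js refl =
  foldl _∩_ K (Ks ++ Js) , refl ,
  subst (_⊑ foldl _∩_ K Ks) (sym (ListP.foldl-++ _∩_ K Ks Js)) (foldl-∩-⊑ (foldl _∩_ K Ks) Js)

⋂-Good : ∀ Is {J} k → J ∈ Is → width J ≤ 2^- k → Good (⋂ Is) k
⋂-Good (I ∷ Is) k (here refl) narrow = ≤-trans (⊑⇒width≤ (foldl-∩-⊑ I Is)) narrow
⋂-Good (I ∷ Is) k (there J∈Is) narrow = ≤-trans (⊑⇒width≤ (foldl-∩-⊑-∈ I Is J∈Is)) narrow

snoc-induction : ∀ {A : Set} (P : List A → Set) → P [] → (∀ xs x → P xs → P (xs ∷ʳ x)) → ∀ xs → P xs
snoc-induction P base step xs = go (reverseView xs)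
  where
  go : ∀ {xs} → Reverse xs → P xs
  go Reverse.[]       = base
  go (xs ∶ view ∶ʳ x) = step xs x (go view)

length-∷ʳ : ∀ {A : Set} (xs : List A) x → length (xs ∷ʳ x) ≡ suc (length xs)
length-∷ʳ xs x = trans (ListP.length-++ xs) (ℕP.+-comm (length xs) 1)

reverse-∷ʳ : ∀ {A : Set} (xs : List A) x → reverse (xs ∷ʳ x) ≡ x ∷ reverse xs
reverse-∷ʳ xs x = ListP.reverse-++ xs [ x ]

reverse-∷-reverse : ∀ {A : Set} x (xs : List A) → reverse (x ∷ reverse xs) ≡ xs ∷ʳ x
reverse-∷-reverse x xs = trans (ListP.unfold-reverse x (reverse xs)) (cong (_∷ʳ x) (ListP.reverse-involutive xs))

applyUpTo-cong : ∀ {A : Set} (f g : ℕ → A) n → (∀ j → j ℕ.< n → f j ≡ g j) → applyUpTo f n ≡ applyUpTo g n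
applyUpTo-cong f g zero    f≡g = refl
applyUpTo-cong f g (suc n) f≡g =
  cong₂ _∷_ (f≡g 0 (ℕ.s≤s ℕ.z≤n)) (applyUpTo-cong (f ∘ suc) (g ∘ suc) n (λ j j<n → f≡g (suc j) (ℕ.s≤s j<n)))

N-∷ʳ : ∀ s (i : Fin 3) → N (s ∷ʳ i) ≡ (2 ℕ.* N s ℕ.+ toℕ i) ℕ.∸ 1
N-∷ʳ s i = ListP.foldl-∷ʳ _ 1 i s

2≤2*N+i : ∀ s (i : Fin 3) → 1 ℕ.≤ N s → 2 ℕ.≤ 2 ℕ.* N s ℕ.+ toℕ i
2≤2*N+i s i 1≤Ns = ℕP.≤-trans (ℕP.*-monoʳ-≤ 2 1≤Ns) (ℕP.m≤m+n (2 ℕ.* N s) (toℕ i))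

1≤N : ∀ s → 1 ℕ.≤ N s
1≤N = snoc-induction _ ℕP.≤-refl λ s i 1≤Ns →
  subst (1 ℕ.≤_) (sym (N-∷ʳ s i)) (ℕP.∸-monoˡ-≤ 1 (2≤2*N+i s i 1≤Ns))

N-∷ʳ-+1 : ∀ s (i : Fin 3) → N (s ∷ʳ i) ℕ.+ 1 ≡ N s ℕ.+ N s ℕ.+ toℕ i
N-∷ʳ-+1 s i = begin
  N (s ∷ʳ i) ℕ.+ 1                      ≡⟨ cong (ℕ._+ 1) (N-∷ʳ s i) ⟩
  (2 ℕ.* N s ℕ.+ toℕ i) ℕ.∸ 1 ℕ.+ 1     ≡⟨ ℕP.m∸n+n≡m (ℕP.≤-trans (ℕ.s≤s ℕ.z≤n) (2≤2*N+i s i (1≤N s))) ⟩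
  2 ℕ.* N s ℕ.+ toℕ i                   ≡⟨ cong (λ n → N s ℕ.+ n ℕ.+ toℕ i) (ℕP.+-identityʳ (N s)) ⟩
  N s ℕ.+ N s ℕ.+ toℕ i                 ∎
  where open ≡-Reasoning

radius : Str → ℚ
radius s = 2^- (suc (length s))

centre : Str → ℚ
centre s = radius s * ℕ→ℚ (N s)

𝕀≡ : ∀ s → 𝕀 s ≡ (centre s - radius s , centre s + radius s)
𝕀≡ s = cong₂ _,_ (solve 2 (λ r n → r :* (n :- con 1ℚ) := r :* n :- r) refl (radius s) (ℕ→ℚ (N s)))
                  (solve 2 (λ r n → r :* (n :+ con 1ℚ) := r :* n :+ r) refl (radius s) (ℕ→ℚ (N s)))

radius-∷ʳ : ∀ s (i : Fin 3) → radius s ≡ radius (s ∷ʳ i) + radius (s ∷ʳ i)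
radius-∷ʳ s i = trans (sym (2^-suc+2^-suc (suc (length s))))
                      (cong (λ l → 2^- (suc l) + 2^- (suc l)) (sym (length-∷ʳ s i)))

centre-∷ʳ : ∀ s (i : Fin 3) → centre (s ∷ʳ i) + radius (s ∷ʳ i) ≡ centre s + radius (s ∷ʳ i) * ℕ→ℚ (toℕ i)
centre-∷ʳ s i = begin
  ρ * ℕ→ℚ (N (s ∷ʳ i)) + ρ                   ≡⟨ solve 2 (λ ρ n → ρ :* n :+ ρ := ρ :* (n :+ con 1ℚ)) refl ρ (ℕ→ℚ (N (s ∷ʳ i))) ⟩
  ρ * (ℕ→ℚ (N (s ∷ʳ i)) + 1ℚ)                ≡⟨ cong (ρ *_) (sym (ℕ→ℚ-+ (N (s ∷ʳ i)) 1)) ⟩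
  ρ * ℕ→ℚ (N (s ∷ʳ i) ℕ.+ 1)                 ≡⟨ cong (λ n → ρ * ℕ→ℚ n) (N-∷ʳ-+1 s i) ⟩
  ρ * ℕ→ℚ (N s ℕ.+ N s ℕ.+ toℕ i)            ≡⟨ cong (ρ *_) (trans (ℕ→ℚ-+ (N s ℕ.+ N s) (toℕ i)) (cong (_+ ℕ→ℚ (toℕ i)) (ℕ→ℚ-+ (N s) (N s)))) ⟩
  ρ * (ℕ→ℚ (N s) + ℕ→ℚ (N s) + ℕ→ℚ (toℕ i))  ≡⟨ solve 3 (λ ρ n j → ρ :* (n :+ n :+ j) := (ρ :+ ρ) :* n :+ ρ :* j) refl ρ (ℕ→ℚ (N s)) (ℕ→ℚ (toℕ i)) ⟩
  (ρ + ρ) * ℕ→ℚ (N s) + ρ * ℕ→ℚ (toℕ i)       ≡⟨ cong (λ r → r * ℕ→ℚ (N s) + ρ * ℕ→ℚ (toℕ i)) (sym (radius-∷ʳ s i)) ⟩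
  centre s + ρ * ℕ→ℚ (toℕ i)                  ∎
  where
  open ≡-Reasoning
  ρ = radius (s ∷ʳ i)

centre-∷ʳ-Close : ∀ s (i : Fin 3) → Close (centre (s ∷ʳ i)) (centre s) (radius (s ∷ʳ i))
centre-∷ʳ-Close s i = Close-offset i (0≤2^- (suc (length (s ∷ʳ i)))) (centre-∷ʳ s i)

𝕀-∷ʳ-⊑ : ∀ s (i : Fin 3) → 𝕀 (s ∷ʳ i) ⊑ 𝕀 s
𝕀-∷ʳ-⊑ s i = subst₂ _⊑_ (sym (𝕀≡ (s ∷ʳ i))) (sym (𝕀≡ s)) child⊑parent
  where
  c′ = centre (s ∷ʳ i)
  ρ = radius (s ∷ʳ i)
  child⊑parent : (c′ - ρ , c′ + ρ) ⊑ (centre s - radius s , centre s + radius s)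
  child⊑parent = subst (λ r → (c′ - ρ , c′ + ρ) ⊑ (centre s - r , centre s + r)) (sym (radius-∷ʳ s i))
                       (Close⇒ball-⊑ (centre-∷ʳ-Close s i))

𝕀-⊑-unit : ∀ s → 𝕀 s ⊑ (0ℚ , 1ℚ)
𝕀-⊑-unit = snoc-induction (λ s → 𝕀 s ⊑ (0ℚ , 1ℚ)) (≤ᵇ⇒≤ _ , ≤ᵇ⇒≤ _) λ s i 𝕀s⊑ → ⊑-trans (𝕀-∷ʳ-⊑ s i) 𝕀s⊑

𝕀-nonempty : ∀ s → proj₁ (𝕀 s) ≤ proj₂ (𝕀 s)
𝕀-nonempty s = subst (λ I → proj₁ I ≤ proj₂ I) (sym (𝕀≡ s))
  (+-monoʳ-≤ (centre s) (≤-trans (neg-antimono-≤ (0≤2^- (suc (length s)))) (0≤2^- (suc (length s)))))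

centre-∈-unit : ∀ s → (0ℚ ≤ centre s) × (centre s ≤ 1ℚ)
centre-∈-unit s =
  ≤-trans 0≤left (≤-trans (+-monoʳ-≤ (centre s) (neg-antimono-≤ (0≤2^- (suc (length s))))) (≤-reflexive (+-identityʳ (centre s)))) ,
  ≤-trans (p≤p+q (centre s) (radius s) (0≤2^- (suc (length s)))) right≤1
  where
  0≤left : 0ℚ ≤ centre s - radius s
  0≤left = ≤-trans (proj₁ (𝕀-⊑-unit s)) (≤-reflexive (cong proj₁ (𝕀≡ s)))
  right≤1 : centre s + radius s ≤ 1ℚ
  right≤1 = ≤-trans (≤-reflexive (sym (cong proj₂ (𝕀≡ s)))) (proj₂ (𝕀-⊑-unit s))

∈𝕀⇒InBall : ∀ s {z} → proj₁ (𝕀 s) ≤ z → z ≤ proj₂ (𝕀 s) → InBall (const z) (centre s) (radius s)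
∈𝕀⇒InBall s {z} left≤z z≤right n =
  ≤-trans z≤c+r (+-monoʳ-≤ (centre s) (p≤p+q (radius s) (2^- n) (0≤2^- n))) ,
  ≤-trans (p-q≤r⇒p≤q+r (≤-trans (≤-reflexive (cong proj₁ (sym (𝕀≡ s)))) left≤z))
          (≤-trans (≤-reflexive (+-comm (radius s) z)) (+-monoʳ-≤ z (p≤p+q (radius s) (2^- n) (0≤2^- n))))
  where
  z≤c+r : z ≤ centre s + radius s
  z≤c+r = ≤-trans z≤right (≤-reflexive (cong proj₂ (𝕀≡ s)))

InBall-∷ʳ : ∀ {x} s (i : Fin 3) → InBall x (centre (s ∷ʳ i)) (radius (s ∷ʳ i)) → InBall x (centre s) (radius s)
InBall-∷ʳ {x} s i x∈B n = Close-mono (≤-reflexive error≡) (Close-trans (x∈B n) (centre-∷ʳ-Close s i))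
  where
  ρ = radius (s ∷ʳ i)
  error≡ : (ρ + 2^- n) + ρ ≡ radius s + 2^- n
  error≡ = trans (solve 2 (λ ρ e → (ρ :+ e) :+ ρ := (ρ :+ ρ) :+ e) refl ρ (2^- n)) (cong (_+ 2^- n) (sym (radius-∷ʳ s i)))

radius-bar : ∀ α n → radius (bar α n) ≡ 2^- (suc n)
radius-bar α n = cong (λ l → 2^- (suc l)) (ListP.length-applyUpTo α n)

Φ≡centre : ∀ α n → Φ α n ≡ centre (bar α n)
Φ≡centre α n = cong (_* ℕ→ℚ (N (bar α n))) (sym (radius-bar α n))

bar-suc : ∀ α n → bar α (suc n) ≡ bar α n ∷ʳ α n
bar-suc α n = sym (ListP.applyUpTo-∷ʳ α n)

Φ-step : ∀ α n → Close (Φ α n) (Φ α (suc n)) (2^- (suc (suc n)))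
Φ-step α n = subst₂ (Close (Φ α n)) (sym (Φ≡centre α (suc n))) (radius-bar α (suc n))
  (subst (λ t → Close (Φ α n) (centre t) (radius t)) (sym (bar-suc α n)) (Close-sym child))
  where
  t = bar α n ∷ʳ α n
  child : Close (centre t) (Φ α n) (radius t)
  child = subst (λ c → Close (centre t) c (radius t)) (sym (Φ≡centre α n)) (centre-∷ʳ-Close (bar α n) (α n))

-- Opaque, or comparing types that mention g k (Φ α) (Φ-InUnit α) unfolds this proof.
opaque
  Φ-InUnit : ∀ α → InUnit (Φ α)
  Φ-InUnit α =
    (λ n → Close⇒∣-∣≤ (Close-mono (2^-suc≤2^- (suc n)) (Φ-step α n))) ,
    (λ n → subst (λ c → (0ℚ ≤ c) × (c ≤ 1ℚ)) (sym (Φ≡centre α n)) (centre-∈-unit (bar α n)))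

Φ-InBall : ∀ α l → InBall (Φ α) (centre (bar α l)) (radius (bar α l))
Φ-InBall α l n = subst (λ c → Close (Φ α n) c (radius (bar α l) + 2^- n)) (Φ≡centre α l) (Close-mono error≤
  (Close-steps {λ n → 2^- (suc n)} (λ n → 2^-suc+2^-suc (suc n)) (λ n → 0≤2^- (suc n)) {Φ α} (Φ-step α) n l))
  where
  error≤ : 2^- (suc n) + 2^- (suc l) ≤ radius (bar α l) + 2^- n
  error≤ = ≤-trans (≤-reflexive (+-comm (2^- (suc n)) (2^- (suc l))))
                   (+-mono-≤ (≤-reflexive (sym (radius-bar α l))) (2^-suc≤2^- n))

extend : Str → ℕ → Fin 3
extend []      n       = Fin.suc Fin.zero
extend (i ∷ s) zero    = i
extend (i ∷ s) (suc n) = extend s n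

bar-extend : ∀ s → bar (extend s) (length s) ≡ s
bar-extend []      = refl
bar-extend (i ∷ s) = cong (i ∷_) (bar-extend s)

extend-bar : ∀ α n j → j ℕ.< n → extend (bar α n) j ≡ α j
extend-bar α (suc n) zero    _         = refl
extend-bar α (suc n) (suc j) (ℕ.s≤s j<n) = extend-bar (α ∘ suc) n j j<n

Φ-extend-bar : ∀ α n i → i ℕ.≤ n → Φ (extend (bar α n)) i ≡ Φ α i
Φ-extend-bar α n i i≤n = cong (λ t → 2^- (suc i) * ℕ→ℚ (N t))
  (applyUpTo-cong (extend (bar α n)) α i (λ j j<i → extend-bar α n j (ℕP.<-≤-trans j<i i≤n)))

just-extract : ∀ m k w → m ≡ just (proj₁ (extract m k w))
just-extract (just I) k w = refl

module Construction (f : UnitFun) (g : ModulusFn) where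

  sample : Str → Seq
  sample t = Φ (extend t)

  sample-InUnit : ∀ t → InUnit (sample t)
  sample-InUnit t = Φ-InUnit (extend t)

  sample-InBall : ∀ t → InBall (sample t) (centre t) (radius t)
  sample-InBall t = subst (λ u → InBall (sample t) (centre u) (radius u)) (bar-extend t)
                          (Φ-InBall (extend t) (length t))

  estimate : Str → ℕ → Interval
  estimate t k = a - 2^- (suc k) , a + 2^- (suc k)
    where a = seq (f (sample t) (sample-InUnit t)) (suc (suc k))

  Admissible : Str → ℕ → Set
  Admissible t k = g (suc (suc k)) (sample t) (sample-InUnit t) ℕ.≤ length t

  admissible? : ∀ t k → Dec (Admissible t k)
  admissible? t k = g (suc (suc k)) (sample t) (sample-InUnit t) ℕ.≤? length t

  new : Str → List Interval
  new t = map (estimate t) (filter (admissible? t) (upTo (suc (length t))))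

  collect : List (Fin 3) → List Interval
  collect []      = new []
  collect (i ∷ r) = collect r ++ new (reverse (i ∷ r))

  -- The estimates made at all prefixes of s; collect recurses on the reversed string.
  candidates : Str → List Interval
  candidates s = collect (reverse s)

  candidates-∷ʳ : ∀ s i → candidates (s ∷ʳ i) ≡ candidates s ++ new (s ∷ʳ i)
  candidates-∷ʳ s i = begin
    collect (reverse (s ∷ʳ i))                              ≡⟨ cong collect (reverse-∷ʳ s i) ⟩
    collect (reverse s) ++ new (reverse (i ∷ reverse s))    ≡⟨ cong (λ t → collect (reverse s) ++ new t) (reverse-∷-reverse i s) ⟩
    collect (reverse s) ++ new (s ∷ʳ i)                     ∎
    where open ≡-Reasoning

  φ : PreCode
  φ s = ⋂ (candidates s)

  Encloses : Str → Interval → Set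
  Encloses s I = ∀ x (x∈[0,1] : InUnit x) → InBall x (centre s) (radius s) → seq (f x x∈[0,1]) ∈ᴵ I

  Encloses-∷ʳ : ∀ s i {I} → Encloses s I → Encloses (s ∷ʳ i) I
  Encloses-∷ʳ s i encl x x∈[0,1] x∈B = encl x x∈[0,1] (InBall-∷ʳ s i x∈B)

  module _ (modulus : IsModulus f g) where

    estimate-encloses : ∀ t k → Admissible t k → Encloses t (estimate t k)
    estimate-encloses t k admissible x x∈[0,1] x∈B =
      Close⇒∈ᴵ {fx} {fs (suc (suc k))} {2^- (suc k)} λ n →
        Close-sym (Close-mono (≤-reflexive (error≡ n))
          (Dist≤⇒Close {fs} {fx} {suc (suc k)} (reg (f (sample t) (sample-InUnit t))) (reg (f x x∈[0,1]))
                       f-close (suc (suc k)) n))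
      where
      fx fs : Seq
      fx = seq (f x x∈[0,1])
      fs = seq (f (sample t) (sample-InUnit t))
      sample≈x : Dist≤ (sample t) x (length t)
      sample≈x = InBall⇒Dist≤ {sample t} {x} {centre t} {length t} (sample-InBall t) x∈B
      f-close : Dist≤ fs fx (suc (suc k))
      f-close = modulus (suc (suc k)) (sample t) x (sample-InUnit t) x∈[0,1]
                        (Dist≤-mono {sample t} {x} {_} {length t} admissible sample≈x)
      error≡ : ∀ n → (2^- (suc (suc k)) + 2^- n) + 2^- (suc (suc k)) ≡ 2^- n + 2^- (suc k)
      error≡ n = trans (solve 2 (λ e a → (e :+ a) :+ e := a :+ (e :+ e)) refl (2^- (suc (suc k))) (2^- n))
                       (cong (2^- n +_) (2^-suc+2^-suc (suc k)))

    new-encloses : ∀ t {I} → I ∈ new t → Encloses t I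
    new-encloses t I∈new =
      let k , _ , I≡estimate , admissible = ∈-map∘filter⁻ (estimate t) (admissible? t) I∈new
      in subst (Encloses t) (sym I≡estimate) (estimate-encloses t k admissible)

    candidates-enclose : ∀ s {I} → I ∈ candidates s → Encloses s I
    candidates-enclose = snoc-induction (λ s → ∀ {I} → I ∈ candidates s → Encloses s I) (new-encloses [])
      λ s i IH {I} I∈ → [ (λ I∈s → Encloses-∷ʳ s i {I} (IH I∈s)) , new-encloses (s ∷ʳ i) ]′
                        (∈-++⁻ (candidates s) (subst (I ∈_) (candidates-∷ʳ s i) I∈))

    φ-encloses : ∀ s {I} → φ s ≡ just I → Encloses s I
    φ-encloses s φs≡I x x∈[0,1] x∈B =
      ∈ᴵ-⋂ {seq (f x x∈[0,1])} (candidates s) φs≡I (λ {J} J∈ → candidates-enclose s {J} J∈ x x∈[0,1] x∈B)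

    φ-nonempty : ∀ s p q → φ s ≡ just (p , q) → p ≤ q
    φ-nonempty s p q φs≡ = ∈ᴵ-overlap {I = p , q} {J = p , q} f-sample∈ f-sample∈
      where
      f-sample∈ : seq (f (sample s) (sample-InUnit s)) ∈ᴵ (p , q)
      f-sample∈ = φ-encloses s φs≡ (sample s) (sample-InUnit s) (sample-InBall s)

    -- Any z in 𝕀 s ∩ 𝕀 t lies in both balls, so f z lies in both φ s and φ t.
    φ-overlap : ∀ s t I J → φ s ≡ just I → φ t ≡ just J → 𝕀 s ≈I 𝕀 t → I ≈I J
    φ-overlap s t I J φs≡I φt≡J (lt≤rs , ls≤rt) =
      ∈ᴵ-overlap {I = I} {J = J} f-z∈I f-z∈J , ∈ᴵ-overlap {I = J} {J = I} f-z∈J f-z∈I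
      where
      z = proj₁ (𝕀 s) ⊔ proj₁ (𝕀 t)
      z≤rs : z ≤ proj₂ (𝕀 s)
      z≤rs = ⊔-lub (𝕀-nonempty s) lt≤rs
      z∈[0,1] : InUnit (const z)
      z∈[0,1] = const-InUnit (≤-trans (proj₁ (𝕀-⊑-unit s)) (p≤p⊔q (proj₁ (𝕀 s)) (proj₁ (𝕀 t))))
                             (≤-trans z≤rs (proj₂ (𝕀-⊑-unit s)))
      f-z∈I : seq (f (const z) z∈[0,1]) ∈ᴵ I
      f-z∈I = φ-encloses s φs≡I (const z) z∈[0,1] (∈𝕀⇒InBall s (p≤p⊔q (proj₁ (𝕀 s)) (proj₁ (𝕀 t))) z≤rs)
      f-z∈J : seq (f (const z) z∈[0,1]) ∈ᴵ J
      f-z∈J = φ-encloses t φt≡J (const z) z∈[0,1] (∈𝕀⇒InBall t (p≤q⊔p (proj₁ (𝕀 s)) (proj₁ (𝕀 t))) (⊔-lub ls≤rt (𝕀-nonempty t)))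

  φ-refines : ∀ s (i : Fin 3) I → φ s ≡ just I → Σ Interval λ I′ → (φ (s ∷ʳ i) ≡ just I′) × (I′ ⊑ I)
  φ-refines s i I φs≡I =
    let I′ , ⋂≡I′ , I′⊑I = ⋂-++-⊑ (candidates s) (new (s ∷ʳ i)) φs≡I
    in I′ , trans (cong ⋂ (candidates-∷ʳ s i)) ⋂≡I′ , I′⊑I

  new⊆candidates : ∀ t {I} → I ∈ new t → I ∈ candidates t
  new⊆candidates = snoc-induction (λ t → ∀ {I} → I ∈ new t → I ∈ candidates t) (λ I∈ → I∈)
    λ s i _ {I} I∈ → subst (I ∈_) (sym (candidates-∷ʳ s i)) (∈-++⁺ʳ (candidates s) I∈)

  width-estimate : ∀ t k → width (estimate t k) ≡ 2^- k
  width-estimate t k = trans (solve 2 (λ a e → (a :+ e) :- (a :- e) := e :+ e) refl a (2^- (suc k)))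
                             (2^-suc+2^-suc k)
    where a = seq (f (sample t) (sample-InUnit t)) (suc (suc k))

  -- Past the depth where g (k+2) stabilises along α, the estimate at precision k is admissible.
  φ-eventually-Good : IsContinuousModulus g → ∀ k α → Σ ℕ λ n → Good (φ (bar α n)) k
  φ-eventually-Good continuous k α = n ,
    ⋂-Good (candidates t) k (new⊆candidates t estimate∈new) (≤-reflexive (width-estimate t k))
    where
    m = proj₁ (continuous (suc (suc k)) (Φ α) (Φ-InUnit α))
    G = g (suc (suc k)) (Φ α) (Φ-InUnit α)
    n = m ℕ.+ (G ℕ.+ k)
    t = bar α n
    length-t : length t ≡ n
    length-t = ListP.length-applyUpTo α n
    G≡ : G ≡ g (suc (suc k)) (sample t) (sample-InUnit t)
    G≡ = proj₂ (continuous (suc (suc k)) (Φ α) (Φ-InUnit α)) (sample t) (sample-InUnit t)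
           (λ i i<m → sym (Φ-extend-bar α n i (ℕP.≤-trans (ℕP.<⇒≤ i<m) (ℕP.m≤m+n m (G ℕ.+ k)))))
    admissible : Admissible t k
    admissible = subst₂ ℕ._≤_ G≡ (sym length-t) (ℕP.≤-trans (ℕP.m≤m+n G k) (ℕP.m≤n+m (G ℕ.+ k) m))
    k∈ : k ∈ upTo (suc (length t))
    k∈ = ∈-upTo⁺ (ℕ.s≤s (subst (k ℕ.≤_) (sym length-t) (ℕP.≤-trans (ℕP.m≤n+m k G) (ℕP.m≤n+m (G ℕ.+ k) m))))
    estimate∈new : estimate t k ∈ new t
    estimate∈new = ∈-map∘filter⁺ (estimate t) (admissible? t) (k , k∈ , refl , admissible)

  isCode : IsModulus f g → IsContinuousModulus g → IsCode φ
  isCode modulus continuous = record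
    { C1 = φ-nonempty modulus
    ; C2 = φ-eventually-Good continuous
    ; C3 = φ-refines
    ; C4 = φ-overlap modulus
    }

  induces : IsModulus f g → (code : IsCode φ) → InducedBy f φ code
  induces modulus code α α∈[0,1] n =
    left-endpoint-approximates {seq (f (Φ α) α∈[0,1])} {𝕁 code α (δ code α (suc n))} n (f∈𝕁 (δ code α (suc n))) narrow
    where
    f∈𝕁 : ∀ j → seq (f (Φ α) α∈[0,1]) ∈ᴵ 𝕁 code α j
    f∈𝕁 j = φ-encloses modulus (bar α (h code α j)) (just-extract _ j (proj₂ (hGood code α j)))
              (Φ α) α∈[0,1] (Φ-InBall α (h code α j))
    narrow : width (𝕁 code α (δ code α (suc n))) ≤ 2^- (suc (suc n))
    narrow = proj₂ (least (λ m → width (𝕁 code α m) ≤? 2^- (suc (suc n)))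
                          (suc (suc n) , proj₂ (𝕁w code α (suc (suc n)))))

lemma6p7 : (f : UnitFun) → RespectsEq f → (g : ModulusFn) →
             IsModulus f g → IsContinuousModulus g →
             Σ PreCode λ φ → Σ (IsCode φ) λ c → InducedBy f φ c
lemma6p7 f _ g modulus continuous = φ , isCode modulus continuous , induces modulus (isCode modulus continuous)
  where open Construction f g
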